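{- If $|q|<1$, then \[ \sum_{n = 1}^\infty \left(\sum_{\pi \in \mathcal{D}(n)} (-1)^{\# (\pi)-s(\pi)} \right) q^n=\sum_{n=1}^{\infty}\frac{(-1)^{n-1}q^{n(n+1)/2}}{(q;q)_{n-1}(1+q^n)}=(q;q)_{\infty}-\frac{(q;q)_\infty}{(-q;q)_{\infty}}. \]
   Context: $\mathcal{D}(n)$ denotes the set of partitions of $n$ into distinct parts; for $\pi\in\mathcal{D}(n)$, $\#(\pi)$ is the number of parts and $s(\pi)$ is the smallest part. Here $(a;q)_n=(1-a)\cdots(1-aq^{n-1})$, $(a;q)_0=1$, $(a;q)_\infty=\prod_{j\ge0}(1-aq^j)$. -}

module Defs where

open import Data.Nat as ℕ using (ℕ; zero; suc; _⊓_; _∸_; _≡ᵇ_)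
open import Data.Nat.DivMod using (_/_)
open import Data.Integer as ℤ using (ℤ; +_; -_; ∣_∣)
open import Data.List using (List; []; _∷_; map; _++_; filter; length; foldr; applyUpTo)
open import Data.Nat.ListAction using () renaming (sum to sumℕ)
open import Data.Bool using (if_then_else_)
open import Relation.Nullary.Decidable using (⌊_⌋)

Series : Set
Series = ℕ → ℤ

sumTo : ℕ → (ℕ → ℤ) → ℤ
sumTo zero    f = f 0
sumTo (suc n) f = sumTo n f ℤ.+ f (suc n)

sumFrom1 : ℕ → (ℕ → ℤ) → ℤ
sumFrom1 zero    f = + 0
sumFrom1 (suc n) f = sumFrom1 n f ℤ.+ f (suc n)

𝟙 : Series
𝟙 zero    = + 1
𝟙 (suc _) = + 0

mono : ℤ → ℕ → Series
mono c m k = if m ≡ᵇ k then c else + 0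

_⊕_ : Series → Series → Series
(f ⊕ g) n = f n ℤ.+ g n

_⊖_ : Series → Series → Series
(f ⊖ g) n = f n ℤ.- g n

_⊛_ : Series → Series → Series
(f ⊛ g) n = sumTo n (λ k → f k ℤ.* g (n ∸ k))

-- Formal inverse of a series with constant term 1:
-- b 0 = 1,  b n = - Σ_{j=1}^{n} f j · b (n - j).
-- invRev f n is the list [b n, b (n-1), …, b 0].

dotFrom : ℕ → Series → List ℤ → ℤ
dotFrom j f []       = + 0
dotFrom j f (c ∷ cs) = f j ℤ.* c ℤ.+ dotFrom (suc j) f cs

invStep : Series → List ℤ → List ℤ
invStep f bs = (- dotFrom 1 f bs) ∷ bs

invRev : Series → ℕ → List ℤ
invRev f zero    = + 1 ∷ []
invRev f (suc n) = invStep f (invRev f n)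

headℤ : List ℤ → ℤ
headℤ []      = + 0
headℤ (x ∷ _) = x

inv : Series → Series
inv f n = headℤ (invRev f n)

-- f / g  (g with constant term 1)
_⊘_ : Series → Series → Series
f ⊘ g = f ⊛ inv g

-- Finite q-Pochhammer (c q^m ; q)_n = ∏_{j<n} (1 - c q^{m+j}).
poch : ℤ → ℕ → ℕ → Series
poch c m zero    = 𝟙
poch c m (suc n) = poch c m n ⊛ (𝟙 ⊖ mono c (m ℕ.+ n))

-- Infinite q-Pochhammer (c q^m ; q)_∞ for m ≥ 1: the coefficient of q^N
-- stabilises once N+1 factors are taken.
pochInf : ℤ → ℕ → Series
pochInf c m N = poch c m (suc N) N

-- Infinite sum Σ_{n≥1} t n where t n has order ≥ n (so terms with n > N
-- do not contribute to the coefficient of q^N).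
sumSeries1 : (ℕ → Series) → Series
sumSeries1 t N = sumFrom1 N (λ n → t n N)

sgn : ℕ → ℤ
sgn zero    = + 1
sgn (suc k) = - sgn k

sgnℤ : ℤ → ℤ
sgnℤ k = sgn ∣ k ∣

sublists : List ℕ → List (List ℕ)
sublists []       = [] ∷ []
sublists (x ∷ xs) = map (x ∷_) (sublists xs) ++ sublists xs

-- 𝒟(n): the sets of distinct positive integers (each necessarily ≤ n)
-- summing to n, each listed as a list of its parts.
𝒟 : ℕ → List (List ℕ)
𝒟 n = filter (λ π → sumℕ π ℕ.≟ n) (sublists (applyUpTo suc n))

numParts : List ℕ → ℕ
numParts = length

-- s(π): smallest part (π nonempty in all uses)
smallest : List ℕ → ℕ
smallest []       = 0
smallest (x ∷ xs) = foldr _⊓_ x xs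

dcount : ℕ → ℤ
dcount n = foldr ℤ._+_ (+ 0)
  (map (λ π → sgnℤ (+ numParts π ℤ.- + smallest π)) (𝒟 n))

lhsSeries : Series
lhsSeries zero    = + 0
lhsSeries (suc n) = dcount (suc n)

midTerm : ℕ → Series
midTerm n = mono (sgn (n ∸ 1)) ((n ℕ.* suc n) / 2)
            ⊘ (poch (+ 1) 1 (n ∸ 1) ⊛ (𝟙 ⊕ mono (+ 1) n))

midSeries : Series
midSeries = sumSeries1 midTerm

rhsSeries : Series
rhsSeries = pochInf (+ 1) 1 ⊖ (pochInf (+ 1) 1 ⊘ pochInf (- + 1) 1)

{-# OPTIONS --safe #-}

-- Splitting off the smallest part s of π, the remaining parts form an arbitrary subset
-- of {s+1, s+2, …}, so the left side is Σ_{s≥1} -(-1)^s q^s (q^{s+1};q)_∞. Put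
-- R(a) = Σ_{s≥0} (-1)^s q^{as} (q^{s+1};q)_∞. The s-th term of R(a) - R(a+1) is
-- (-1)^s q^{as} (q^s;q)_∞, which is -q^a times the (s-1)-st term of R(a); hence
-- R(a+1) = (1 + q^a) R(a), and as R(a) → (q;q)_∞ we get R(1) = (q;q)_∞ / (-q;q)_∞.
-- The left side is (q;q)_∞ - R(1). For the middle series expand 1/(1 + q^n) geometrically
-- and (q^{s+1};q)_∞ by Euler's identity (proved by the same telescoping): both sides
-- become Σ_{t,m} (-1)^{t+m} q^{(t+1)(m+1) + m(m+1)/2} / (q;q)_m. Everything is
-- compared modulo q^{N+1}, where all infinite sums and products are finite.

module Submission where

open import Data.Bool using (true; false)
open import Data.Integer as ℤ using (ℤ; +_; -_)
import Data.Integer.Properties as ℤₚ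
open import Data.Integer.Solver using (module +-*-Solver)
open import Data.List using (List; []; _∷_; map; _++_; filter; length; foldr; applyUpTo)
open import Data.List.Properties using (filter-accept; filter-reject)
open import Data.List.Relation.Unary.All as All using (All; []; _∷_)
import Data.List.Relation.Unary.All.Properties as Allₚ
open import Data.Nat as ℕ using (ℕ; zero; suc; _+_; _*_; _∸_; _≤_; _<_; z≤n; s≤s; _≡ᵇ_)
open import Data.Nat.DivMod using (_/_; m*n/n≡m)
open import Data.Nat.ListAction using () renaming (sum to sumℕ)
import Data.Nat.Properties as ℕₚ
import Data.Nat.Solver as ℕ-Solver
open import Data.Product using (_×_; _,_)
open import Function using (_∘_)
open import Level using (0ℓ)
open import Relation.Binary.Bundles using (Setoid)
open import Relation.Binary.PropositionalEquality
import Relation.Binary.Reasoning.Setoid as SetoidReasoning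
open import Relation.Nullary using (yes; no)

open import Defs

sumTo-cong : ∀ n {f g : ℕ → ℤ} → (∀ i → i ≤ n → f i ≡ g i) → sumTo n f ≡ sumTo n g
sumTo-cong zero    f≡g = f≡g 0 z≤n
sumTo-cong (suc n) f≡g =
  cong₂ ℤ._+_ (sumTo-cong n (λ i i≤n → f≡g i (ℕₚ.m≤n⇒m≤1+n i≤n))) (f≡g (suc n) ℕₚ.≤-refl)

sumTo-ext : ∀ n {f g : ℕ → ℤ} → f ≗ g → sumTo n f ≡ sumTo n g
sumTo-ext n f≗g = sumTo-cong n (λ i _ → f≗g i)

sumTo-+ : ∀ n (f g : ℕ → ℤ) → sumTo n (λ i → f i ℤ.+ g i) ≡ sumTo n f ℤ.+ sumTo n g
sumTo-+ zero    f g = refl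
sumTo-+ (suc n) f g = trans (cong (ℤ._+ (f (suc n) ℤ.+ g (suc n))) (sumTo-+ n f g))
  (solve 4 (λ a b c d → (a :+ b) :+ (c :+ d) := (a :+ c) :+ (b :+ d)) refl
     (sumTo n f) (sumTo n g) (f (suc n)) (g (suc n)))
  where open +-*-Solver

sumTo-*ˡ : ∀ n c (f : ℕ → ℤ) → c ℤ.* sumTo n f ≡ sumTo n (λ i → c ℤ.* f i)
sumTo-*ˡ zero    c f = refl
sumTo-*ˡ (suc n) c f =
  trans (ℤₚ.*-distribˡ-+ c (sumTo n f) (f (suc n))) (cong (ℤ._+ c ℤ.* f (suc n)) (sumTo-*ˡ n c f))

sumTo-zero : ∀ n → sumTo n (λ _ → + 0) ≡ + 0
sumTo-zero zero    = refl
sumTo-zero (suc n) = cong (ℤ._+ + 0) (sumTo-zero n)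

sumTo-neg : ∀ n (f : ℕ → ℤ) → - sumTo n f ≡ sumTo n (λ i → - f i)
sumTo-neg zero    f = refl
sumTo-neg (suc n) f =
  trans (ℤₚ.neg-distrib-+ (sumTo n f) (f (suc n))) (cong (ℤ._+ - f (suc n)) (sumTo-neg n f))

sumTo-suc : ∀ n (f : ℕ → ℤ) → sumTo (suc n) f ≡ f 0 ℤ.+ sumTo n (f ∘ suc)
sumTo-suc zero    f = refl
sumTo-suc (suc n) f = trans (cong (ℤ._+ f (suc (suc n))) (sumTo-suc n f)) (ℤₚ.+-assoc (f 0) _ _)

sumTo-swap : ∀ n m (F : ℕ → ℕ → ℤ) →
             sumTo n (λ i → sumTo m (F i)) ≡ sumTo m (λ j → sumTo n (λ i → F i j))
sumTo-swap zero    m F = refl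
sumTo-swap (suc n) m F = trans (cong (ℤ._+ sumTo m (F (suc n))) (sumTo-swap n m F))
  (sym (sumTo-+ m (λ j → sumTo n (λ i → F i j)) (F (suc n))))

sumFrom1-suc : ∀ n f → sumFrom1 (suc n) f ≡ sumTo n (f ∘ suc)
sumFrom1-suc zero    f = ℤₚ.+-identityˡ (f 1)
sumFrom1-suc (suc n) f = cong (ℤ._+ f (suc (suc n))) (sumFrom1-suc n f)

infix 4 _≈[_]_
_≈[_]_ : Series → ℕ → Series → Set
f ≈[ K ] g = ∀ k → k ≤ K → f k ≡ g k

≈-refl : ∀ {f K} → f ≈[ K ] f
≈-refl k _ = refl

≈-sym : ∀ {f g K} → f ≈[ K ] g → g ≈[ K ] f
≈-sym f≈g k k≤K = sym (f≈g k k≤K)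

≈-trans : ∀ {f g h K} → f ≈[ K ] g → g ≈[ K ] h → f ≈[ K ] h
≈-trans f≈g g≈h k k≤K = trans (f≈g k k≤K) (g≈h k k≤K)

≗⇒≈ : ∀ {f g K} → f ≗ g → f ≈[ K ] g
≗⇒≈ f≗g k _ = f≗g k

≈-setoid : ℕ → Setoid 0ℓ 0ℓ
≈-setoid K = record
  { Carrier       = Series
  ; _≈_           = _≈[ K ]_
  ; isEquivalence = record { refl = ≈-refl ; sym = ≈-sym ; trans = ≈-trans }
  }

⊖≈⇒≈⊕ : ∀ {K} x y w → (x ⊖ y) ≈[ K ] w → x ≈[ K ] (y ⊕ w)
⊖≈⇒≈⊕ x y w x-y≈w k k≤K = trans (solve 2 (λ a b → a := b :+ (a :- b)) refl (x k) (y k))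
  (cong (ℤ._+_ (y k)) (x-y≈w k k≤K))
  where open +-*-Solver

⊖≈⇒≈⊖ : ∀ {K} x y w → (x ⊖ y) ≈[ K ] w → y ≈[ K ] (x ⊖ w)
⊖≈⇒≈⊖ x y w x-y≈w k k≤K = trans (solve 2 (λ a b → b := a :- (a :- b)) refl (x k) (y k))
  (cong (ℤ._-_ (x k)) (x-y≈w k k≤K))
  where open +-*-Solver

𝟘 : Series
𝟘 _ = + 0

_*ₗ_ : ℤ → Series → Series
(c *ₗ f) n = c ℤ.* f n

⊛-sucˡ : ∀ f g n → (f ⊛ g) (suc n) ≡ f 0 ℤ.* g (suc n) ℤ.+ ((f ∘ suc) ⊛ g) n
⊛-sucˡ f g n = sumTo-suc n (λ k → f k ℤ.* g (suc n ∸ k))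

⊛-sucʳ : ∀ f g n → (f ⊛ g) (suc n) ≡ (f ⊛ (g ∘ suc)) n ℤ.+ f (suc n) ℤ.* g 0
⊛-sucʳ f g n = cong₂ ℤ._+_
  (sumTo-cong n (λ k k≤n → cong (λ x → f k ℤ.* g x) (ℕₚ.+-∸-assoc 1 k≤n)))
  (cong (λ x → f (suc n) ℤ.* g x) (ℕₚ.n∸n≡0 n))

⊛-congˡ : ∀ {f f′ K} g → f ≈[ K ] f′ → (f ⊛ g) ≈[ K ] (f′ ⊛ g)
⊛-congˡ g f≈f′ k k≤K =
  sumTo-cong k (λ j j≤k → cong (ℤ._* g (k ∸ j)) (f≈f′ j (ℕₚ.≤-trans j≤k k≤K)))

⊛-congʳ : ∀ {g g′ K} f → g ≈[ K ] g′ → (f ⊛ g) ≈[ K ] (f ⊛ g′)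
⊛-congʳ f g≈g′ k k≤K =
  sumTo-cong k (λ j _ → cong (f j ℤ.*_) (g≈g′ (k ∸ j) (ℕₚ.≤-trans (ℕₚ.m∸n≤m k j) k≤K)))

⊛-congˡ-≗ : ∀ {f f′} g → f ≗ f′ → (f ⊛ g) ≗ (f′ ⊛ g)
⊛-congˡ-≗ g f≗f′ k = ⊛-congˡ g (≗⇒≈ f≗f′) k ℕₚ.≤-refl

⊛-congʳ-≗ : ∀ {g g′} f → g ≗ g′ → (f ⊛ g) ≗ (f ⊛ g′)
⊛-congʳ-≗ f g≗g′ k = ⊛-congʳ f (≗⇒≈ g≗g′) k ℕₚ.≤-refl

⊛-comm : ∀ f g → (f ⊛ g) ≗ (g ⊛ f)
⊛-comm f g zero    = ℤₚ.*-comm (f 0) (g 0)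
⊛-comm f g (suc n) = begin
  (f ⊛ g) (suc n)                          ≡⟨ ⊛-sucˡ f g n ⟩
  f 0 ℤ.* g (suc n) ℤ.+ ((f ∘ suc) ⊛ g) n  ≡⟨ cong₂ ℤ._+_ (ℤₚ.*-comm (f 0) (g (suc n))) (⊛-comm (f ∘ suc) g n) ⟩
  g (suc n) ℤ.* f 0 ℤ.+ (g ⊛ (f ∘ suc)) n  ≡⟨ ℤₚ.+-comm (g (suc n) ℤ.* f 0) _ ⟩
  (g ⊛ (f ∘ suc)) n ℤ.+ g (suc n) ℤ.* f 0  ≡⟨ sym (⊛-sucʳ g f n) ⟩
  (g ⊛ f) (suc n)                          ∎
  where open ≡-Reasoning

⊛-distribʳ-⊕ : ∀ f h g → ((f ⊕ h) ⊛ g) ≗ ((f ⊛ g) ⊕ (h ⊛ g))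
⊛-distribʳ-⊕ f h g n =
  trans (sumTo-ext n (λ k → ℤₚ.*-distribʳ-+ (g (n ∸ k)) (f k) (h k))) (sumTo-+ n _ _)

⊛-distribʳ-⊖ : ∀ f h g → ((f ⊖ h) ⊛ g) ≗ ((f ⊛ g) ⊖ (h ⊛ g))
⊛-distribʳ-⊖ f h g n = begin
  sumTo n (λ k → (f k ℤ.- h k) ℤ.* g (n ∸ k))
    ≡⟨ sumTo-ext n (λ k → trans (ℤₚ.*-distribʳ-+ (g (n ∸ k)) (f k) (- h k))
                                (cong (ℤ._+_ (f k ℤ.* g (n ∸ k))) (sym (ℤₚ.neg-distribˡ-* (h k) (g (n ∸ k)))))) ⟩
  sumTo n (λ k → f k ℤ.* g (n ∸ k) ℤ.- h k ℤ.* g (n ∸ k))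
    ≡⟨ sumTo-+ n _ _ ⟩
  (f ⊛ g) n ℤ.+ sumTo n (λ k → - (h k ℤ.* g (n ∸ k)))
    ≡⟨ cong (ℤ._+_ ((f ⊛ g) n)) (sym (sumTo-neg n _)) ⟩
  (f ⊛ g) n ℤ.- (h ⊛ g) n ∎
  where open ≡-Reasoning

*ₗ-⊛ : ∀ c f g → ((c *ₗ f) ⊛ g) ≗ (c *ₗ (f ⊛ g))
*ₗ-⊛ c f g n = trans (sumTo-ext n (λ k → ℤₚ.*-assoc c (f k) (g (n ∸ k)))) (sym (sumTo-*ˡ n c _))

⊛-zeroˡ : ∀ g → (𝟘 ⊛ g) ≗ 𝟘
⊛-zeroˡ g n = trans (sumTo-ext n (λ k → ℤₚ.*-zeroˡ (g (n ∸ k)))) (sumTo-zero n)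

⊛-zeroʳ : ∀ g → (g ⊛ 𝟘) ≗ 𝟘
⊛-zeroʳ g n = trans (⊛-comm g 𝟘 n) (⊛-zeroˡ g n)

⊛-identityˡ : ∀ g → (𝟙 ⊛ g) ≗ g
⊛-identityˡ g zero    = ℤₚ.*-identityˡ (g 0)
⊛-identityˡ g (suc n) = begin
  (𝟙 ⊛ g) (suc n)                    ≡⟨ ⊛-sucˡ 𝟙 g n ⟩
  + 1 ℤ.* g (suc n) ℤ.+ (𝟘 ⊛ g) n    ≡⟨ cong₂ ℤ._+_ (ℤₚ.*-identityˡ (g (suc n))) (⊛-zeroˡ g n) ⟩
  g (suc n) ℤ.+ + 0                  ≡⟨ ℤₚ.+-identityʳ _ ⟩
  g (suc n)                          ∎
  where open ≡-Reasoning

⊛-identityʳ : ∀ g → (g ⊛ 𝟙) ≗ g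
⊛-identityʳ g n = trans (⊛-comm g 𝟙 n) (⊛-identityˡ g n)

⊛-distribˡ-⊕ : ∀ g f h → (g ⊛ (f ⊕ h)) ≗ ((g ⊛ f) ⊕ (g ⊛ h))
⊛-distribˡ-⊕ g f h n = trans (⊛-comm g (f ⊕ h) n)
  (trans (⊛-distribʳ-⊕ f h g n) (cong₂ ℤ._+_ (⊛-comm f g n) (⊛-comm h g n)))

⊛-distribˡ-⊖ : ∀ g f h → (g ⊛ (f ⊖ h)) ≗ ((g ⊛ f) ⊖ (g ⊛ h))
⊛-distribˡ-⊖ g f h n = trans (⊛-comm g (f ⊖ h) n)
  (trans (⊛-distribʳ-⊖ f h g n) (cong₂ ℤ._-_ (⊛-comm f g n) (⊛-comm h g n)))

⊛-*ₗ : ∀ c g f → (g ⊛ (c *ₗ f)) ≗ (c *ₗ (g ⊛ f))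
⊛-*ₗ c g f n = trans (⊛-comm g (c *ₗ f) n) (trans (*ₗ-⊛ c f g n) (cong (c ℤ.*_) (⊛-comm f g n)))

⊛-assoc : ∀ f g h → ((f ⊛ g) ⊛ h) ≗ (f ⊛ (g ⊛ h))
⊛-assoc f g h zero    = ℤₚ.*-assoc (f 0) (g 0) (h 0)
⊛-assoc f g h (suc n) = begin
  ((f ⊛ g) ⊛ h) (suc n)
    ≡⟨ ⊛-sucˡ (f ⊛ g) h n ⟩
  f₀g₀ ℤ.* h (suc n) ℤ.+ (((f ⊛ g) ∘ suc) ⊛ h) n
    ≡⟨ cong (ℤ._+_ (f₀g₀ ℤ.* h (suc n))) (⊛-congˡ-≗ h (⊛-sucˡ f g) n) ⟩
  f₀g₀ ℤ.* h (suc n) ℤ.+ (((f 0 *ₗ (g ∘ suc)) ⊕ ((f ∘ suc) ⊛ g)) ⊛ h) n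
    ≡⟨ cong (ℤ._+_ (f₀g₀ ℤ.* h (suc n))) (⊛-distribʳ-⊕ (f 0 *ₗ (g ∘ suc)) ((f ∘ suc) ⊛ g) h n) ⟩
  f₀g₀ ℤ.* h (suc n) ℤ.+ (((f 0 *ₗ (g ∘ suc)) ⊛ h) n ℤ.+ (((f ∘ suc) ⊛ g) ⊛ h) n)
    ≡⟨ cong₂ (λ a b → f₀g₀ ℤ.* h (suc n) ℤ.+ (a ℤ.+ b))
             (*ₗ-⊛ (f 0) (g ∘ suc) h n) (⊛-assoc (f ∘ suc) g h n) ⟩
  f₀g₀ ℤ.* h (suc n) ℤ.+ (f 0 ℤ.* ((g ∘ suc) ⊛ h) n ℤ.+ ((f ∘ suc) ⊛ (g ⊛ h)) n)
    ≡⟨ solve 5 (λ a b c d e → (a :* b) :* c :+ (a :* d :+ e) := a :* (b :* c :+ d) :+ e) refl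
             (f 0) (g 0) (h (suc n)) (((g ∘ suc) ⊛ h) n) (((f ∘ suc) ⊛ (g ⊛ h)) n) ⟩
  f 0 ℤ.* (g 0 ℤ.* h (suc n) ℤ.+ ((g ∘ suc) ⊛ h) n) ℤ.+ ((f ∘ suc) ⊛ (g ⊛ h)) n
    ≡⟨ cong (λ x → f 0 ℤ.* x ℤ.+ ((f ∘ suc) ⊛ (g ⊛ h)) n) (sym (⊛-sucˡ g h n)) ⟩
  f 0 ℤ.* (g ⊛ h) (suc n) ℤ.+ ((f ∘ suc) ⊛ (g ⊛ h)) n
    ≡⟨ sym (⊛-sucˡ f (g ⊛ h) n) ⟩
  (f ⊛ (g ⊛ h)) (suc n) ∎
  where
    open ≡-Reasoning
    open +-*-Solver
    f₀g₀ = f 0 ℤ.* g 0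

⊛-interchange : ∀ a b c d → ((a ⊛ b) ⊛ (c ⊛ d)) ≗ ((a ⊛ c) ⊛ (b ⊛ d))
⊛-interchange a b c d k = begin
  ((a ⊛ b) ⊛ (c ⊛ d)) k  ≡⟨ ⊛-assoc a b (c ⊛ d) k ⟩
  (a ⊛ (b ⊛ (c ⊛ d))) k  ≡⟨ ⊛-congʳ-≗ a (λ j → sym (⊛-assoc b c d j)) k ⟩
  (a ⊛ ((b ⊛ c) ⊛ d)) k  ≡⟨ ⊛-congʳ-≗ a (⊛-congˡ-≗ d (⊛-comm b c)) k ⟩
  (a ⊛ ((c ⊛ b) ⊛ d)) k  ≡⟨ ⊛-congʳ-≗ a (⊛-assoc c b d) k ⟩
  (a ⊛ (c ⊛ (b ⊛ d))) k  ≡⟨ sym (⊛-assoc a c (b ⊛ d) k) ⟩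
  ((a ⊛ c) ⊛ (b ⊛ d)) k  ∎
  where open ≡-Reasoning

𝟙⊕f-⊛ : ∀ f x → ((𝟙 ⊕ f) ⊛ x) ≗ (x ⊕ (f ⊛ x))
𝟙⊕f-⊛ f x k = trans (⊛-distribʳ-⊕ 𝟙 f x k) (cong (ℤ._+ (f ⊛ x) k) (⊛-identityˡ x k))

𝟙⊖f-⊛ : ∀ f x → ((𝟙 ⊖ f) ⊛ x) ≗ (x ⊖ (f ⊛ x))
𝟙⊖f-⊛ f x k = trans (⊛-distribʳ-⊖ 𝟙 f x k) (cong (ℤ._- (f ⊛ x) k) (⊛-identityˡ x k))

descending : (ℕ → ℤ) → ℕ → List ℤ
descending b zero    = b 0 ∷ []
descending b (suc n) = b (suc n) ∷ descending b n

invRev≡descending : ∀ g n → invRev g n ≡ descending (inv g) n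
invRev≡descending g zero    = refl
invRev≡descending g (suc n) = cong (inv g (suc n) ∷_) (invRev≡descending g n)

dotFrom-descending : ∀ g b n j → dotFrom j g (descending b n) ≡ sumTo n (λ i → g (j + i) ℤ.* b (n ∸ i))
dotFrom-descending g b zero    j rewrite ℕₚ.+-identityʳ j = ℤₚ.+-identityʳ _
dotFrom-descending g b (suc n) j = begin
  g j ℤ.* b (suc n) ℤ.+ dotFrom (suc j) g (descending b n)
    ≡⟨ cong₂ ℤ._+_ (cong (λ x → g x ℤ.* b (suc n)) (sym (ℕₚ.+-identityʳ j))) (dotFrom-descending g b n (suc j)) ⟩
  g (j + 0) ℤ.* b (suc n) ℤ.+ sumTo n (λ i → g (suc j + i) ℤ.* b (n ∸ i))
    ≡⟨ cong (ℤ._+_ (g (j + 0) ℤ.* b (suc n)))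
            (sumTo-ext n (λ i → cong (λ x → g x ℤ.* b (n ∸ i)) (sym (ℕₚ.+-suc j i)))) ⟩
  g (j + 0) ℤ.* b (suc n) ℤ.+ sumTo n (λ i → g (j + suc i) ℤ.* b (n ∸ i))
    ≡⟨ sym (sumTo-suc n (λ i → g (j + i) ℤ.* b (suc n ∸ i))) ⟩
  sumTo (suc n) (λ i → g (j + i) ℤ.* b (suc n ∸ i)) ∎
  where open ≡-Reasoning

⊛-inverseʳ : ∀ g → g 0 ≡ + 1 → (g ⊛ inv g) ≗ 𝟙
⊛-inverseʳ g g₀≡1 zero    rewrite g₀≡1 = refl
⊛-inverseʳ g g₀≡1 (suc n) = begin
  (g ⊛ inv g) (suc n)                             ≡⟨ ⊛-sucˡ g (inv g) n ⟩
  g 0 ℤ.* inv g (suc n) ℤ.+ ((g ∘ suc) ⊛ inv g) n ≡⟨ cong₂ (λ a b → a ℤ.* inv g (suc n) ℤ.+ b) g₀≡1 (sym D≡) ⟩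
  + 1 ℤ.* (- D) ℤ.+ D                             ≡⟨ cong (ℤ._+ D) (ℤₚ.*-identityˡ (- D)) ⟩
  - D ℤ.+ D                                       ≡⟨ ℤₚ.+-inverseˡ D ⟩
  + 0                                             ∎
  where
    open ≡-Reasoning
    D = dotFrom 1 g (invRev g n)
    D≡ : D ≡ ((g ∘ suc) ⊛ inv g) n
    D≡ = trans (cong (dotFrom 1 g) (invRev≡descending g n)) (dotFrom-descending g (inv g) n 1)

⊛-inverseˡ : ∀ g → g 0 ≡ + 1 → (inv g ⊛ g) ≗ 𝟙
⊛-inverseˡ g g₀≡1 k = trans (⊛-comm (inv g) g k) (⊛-inverseʳ g g₀≡1 k)

⊘-unique : ∀ {K} X g F → g 0 ≡ + 1 → (X ⊛ g) ≈[ K ] F → X ≈[ K ] (F ⊘ g)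
⊘-unique X g F g₀≡1 X⊛g≈F k k≤K = begin
  X k                  ≡⟨ sym (⊛-identityʳ X k) ⟩
  (X ⊛ 𝟙) k            ≡⟨ sym (⊛-congʳ-≗ X (⊛-inverseʳ g g₀≡1) k) ⟩
  (X ⊛ (g ⊛ inv g)) k  ≡⟨ sym (⊛-assoc X g (inv g) k) ⟩
  ((X ⊛ g) ⊛ inv g) k  ≡⟨ ⊛-congˡ (inv g) X⊛g≈F k k≤K ⟩
  (F ⊛ inv g) k        ∎
  where open ≡-Reasoning

inv-unique : ∀ {K} X g → g 0 ≡ + 1 → (X ⊛ g) ≈[ K ] 𝟙 → X ≈[ K ] inv g
inv-unique X g g₀≡1 X⊛g≈𝟙 = ≈-trans (⊘-unique X g 𝟙 g₀≡1 X⊛g≈𝟙) (≗⇒≈ (⊛-identityˡ (inv g)))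

inv-cong : ∀ {K} f g → f 0 ≡ + 1 → g 0 ≡ + 1 → f ≈[ K ] g → inv f ≈[ K ] inv g
inv-cong f g f₀≡1 g₀≡1 f≈g =
  inv-unique (inv f) g g₀≡1 (≈-trans (⊛-congʳ (inv f) (≈-sym f≈g)) (≗⇒≈ (⊛-inverseˡ f f₀≡1)))

inv-⊛ : ∀ f g → f 0 ≡ + 1 → g 0 ≡ + 1 → inv (f ⊛ g) ≗ (inv f ⊛ inv g)
inv-⊛ f g f₀≡1 g₀≡1 k =
  sym (inv-unique (inv f ⊛ inv g) (f ⊛ g) (cong₂ ℤ._*_ f₀≡1 g₀≡1) (≗⇒≈ product≗𝟙) k ℕₚ.≤-refl)
  where
    open ≡-Reasoning
    product≗𝟙 : ((inv f ⊛ inv g) ⊛ (f ⊛ g)) ≗ 𝟙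
    product≗𝟙 j = begin
      ((inv f ⊛ inv g) ⊛ (f ⊛ g)) j  ≡⟨ ⊛-interchange (inv f) (inv g) f g j ⟩
      ((inv f ⊛ f) ⊛ (inv g ⊛ g)) j  ≡⟨ ⊛-congˡ-≗ (inv g ⊛ g) (⊛-inverseˡ f f₀≡1) j ⟩
      (𝟙 ⊛ (inv g ⊛ g)) j            ≡⟨ ⊛-identityˡ (inv g ⊛ g) j ⟩
      (inv g ⊛ g) j                  ≡⟨ ⊛-inverseˡ g g₀≡1 j ⟩
      𝟙 j                            ∎

inv-𝟙 : inv 𝟙 ≗ 𝟙
inv-𝟙 k = trans (sym (⊛-identityˡ (inv 𝟙) k)) (⊛-inverseʳ 𝟙 refl k)

data Offset (m : ℕ) : ℕ → Set where
  below : ∀ {k} → k < m → Offset m k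
  above : ∀ j → Offset m (m + j)

offset : ∀ m k → Offset m k
offset zero    k    = above k
offset (suc m) zero = below (s≤s z≤n)
offset (suc m) (suc k) with offset m k
... | below k<m = below (s≤s k<m)
... | above j   = above j

mono-< : ∀ c {m k} → k < m → mono c m k ≡ + 0
mono-< c {suc m} {zero}  _         = refl
mono-< c {suc m} {suc k} (s≤s k<m) = mono-< c k<m

mono-+ : ∀ c a b j → mono c (a + b) (a + j) ≡ mono c b j
mono-+ c zero    b j = refl
mono-+ c (suc a) b j = mono-+ c a b j

*ₗ-mono : ∀ c d m → (c *ₗ mono d m) ≗ mono (c ℤ.* d) m
*ₗ-mono c d m k with m ≡ᵇ k
... | true  = refl
... | false = ℤₚ.*-zeroʳ c

mono-⊛-< : ∀ c m f {k} → k < m → (mono c m ⊛ f) k ≡ + 0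
mono-⊛-< c (suc m) f {zero}  _         = ℤₚ.*-zeroˡ (f 0)
mono-⊛-< c (suc m) f {suc k} (s≤s k<m) =
  trans (⊛-sucˡ (mono c (suc m)) f k) (cong₂ ℤ._+_ (ℤₚ.*-zeroˡ (f (suc k))) (mono-⊛-< c m f k<m))

mono-⊛-+ : ∀ c m f n → (mono c m ⊛ f) (m + n) ≡ c ℤ.* f n
mono-⊛-+ c zero    f zero    = refl
mono-⊛-+ c zero    f (suc n) = trans (⊛-sucˡ (mono c 0) f n)
  (trans (cong (ℤ._+_ (c ℤ.* f (suc n))) (⊛-zeroˡ f n)) (ℤₚ.+-identityʳ _))
mono-⊛-+ c (suc m) f n = trans (⊛-sucˡ (mono c (suc m)) f (m + n))
  (trans (cong₂ ℤ._+_ (ℤₚ.*-zeroˡ (f (suc (m + n)))) (mono-⊛-+ c m f n)) (ℤₚ.+-identityˡ _))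

mono-⊛-≈𝟘 : ∀ {K} c m f → K < m → (mono c m ⊛ f) ≈[ K ] 𝟘
mono-⊛-≈𝟘 c m f K<m k k≤K = mono-⊛-< c m f (ℕₚ.≤-<-trans k≤K K<m)

mono-0-⊛ : ∀ f → (mono (+ 1) 0 ⊛ f) ≗ f
mono-0-⊛ f k = trans (mono-⊛-+ (+ 1) 0 f k) (ℤₚ.*-identityˡ (f k))

mono-⊛-*ₗ : ∀ c m f → (mono c m ⊛ f) ≗ (c *ₗ (mono (+ 1) m ⊛ f))
mono-⊛-*ₗ c m f k = begin
  (mono c m ⊛ f) k                 ≡⟨ cong (λ d → (mono d m ⊛ f) k) (sym (ℤₚ.*-identityʳ c)) ⟩
  (mono (c ℤ.* + 1) m ⊛ f) k       ≡⟨ ⊛-congˡ-≗ f (λ j → sym (*ₗ-mono c (+ 1) m j)) k ⟩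
  ((c *ₗ mono (+ 1) m) ⊛ f) k      ≡⟨ *ₗ-⊛ c (mono (+ 1) m) f k ⟩
  c ℤ.* (mono (+ 1) m ⊛ f) k       ∎
  where open ≡-Reasoning

*ₗ-mono-⊛ : ∀ c d a X → (c *ₗ (mono d a ⊛ X)) ≗ (mono (c ℤ.* d) a ⊛ X)
*ₗ-mono-⊛ c d a X k = trans (sym (*ₗ-⊛ c (mono d a) X k)) (⊛-congˡ-≗ X (*ₗ-mono c d a) k)

mono-⊛-mono : ∀ c d a b → (mono c a ⊛ mono d b) ≗ mono (c ℤ.* d) (a + b)
mono-⊛-mono c d a b k with offset a k
... | below k<a = trans (mono-⊛-< c a (mono d b) k<a)
                        (sym (mono-< (c ℤ.* d) (ℕₚ.<-≤-trans k<a (ℕₚ.m≤m+n a b))))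
... | above j   = trans (mono-⊛-+ c a (mono d b) j)
                        (trans (*ₗ-mono c d b j) (sym (mono-+ (c ℤ.* d) a b j)))

mono-⊛-mono-⊛ : ∀ c d a b f → (mono c a ⊛ (mono d b ⊛ f)) ≗ (mono (c ℤ.* d) (a + b) ⊛ f)
mono-⊛-mono-⊛ c d a b f k =
  trans (sym (⊛-assoc (mono c a) (mono d b) f k)) (⊛-congˡ-≗ f (mono-⊛-mono c d a b) k)

mono-⊛-⊖ : ∀ c e m X → ((mono c e ⊛ X) ⊖ (mono c (m + e) ⊛ X)) ≗ (mono c e ⊛ ((𝟙 ⊖ mono (+ 1) m) ⊛ X))
mono-⊛-⊖ c e m X k = begin
  (mono c e ⊛ X) k ℤ.- (mono c (m + e) ⊛ X) k
    ≡⟨ cong₂ ℤ._-_ (sym (⊛-congʳ-≗ (mono c e) (⊛-identityˡ X) k))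
                   (trans (cong₂ (λ d x → (mono d x ⊛ X) k) (sym (ℤₚ.*-identityʳ c)) (ℕₚ.+-comm m e))
                          (sym (mono-⊛-mono-⊛ c (+ 1) e m X k))) ⟩
  (mono c e ⊛ (𝟙 ⊛ X)) k ℤ.- (mono c e ⊛ (mono (+ 1) m ⊛ X)) k
    ≡⟨ sym (⊛-distribˡ-⊖ (mono c e) (𝟙 ⊛ X) (mono (+ 1) m ⊛ X) k) ⟩
  (mono c e ⊛ ((𝟙 ⊛ X) ⊖ (mono (+ 1) m ⊛ X))) k
    ≡⟨ sym (⊛-congʳ-≗ (mono c e) (⊛-distribʳ-⊖ 𝟙 (mono (+ 1) m) X) k) ⟩
  (mono c e ⊛ ((𝟙 ⊖ mono (+ 1) m) ⊛ X)) k ∎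
  where open ≡-Reasoning

𝟙⊖mono-0 : (𝟙 ⊖ mono (+ 1) 0) ≗ 𝟘
𝟙⊖mono-0 zero    = refl
𝟙⊖mono-0 (suc k) = refl

𝟙⊕mono-neg : ∀ a → (𝟙 ⊕ mono (- + 1) a) ≗ (𝟙 ⊖ mono (+ 1) a)
𝟙⊕mono-neg a k with a ≡ᵇ k
... | true  = refl
... | false = refl

poch-unfoldˡ : ∀ c m n → poch c m (suc n) ≗ ((𝟙 ⊖ mono c m) ⊛ poch c (suc m) n)
poch-unfoldˡ c m zero k rewrite ℕₚ.+-identityʳ m =
  trans (⊛-identityˡ (𝟙 ⊖ mono c m) k) (sym (⊛-identityʳ (𝟙 ⊖ mono c m) k))
poch-unfoldˡ c m (suc n) k = begin
  (poch c m (suc n) ⊛ L) k                      ≡⟨ ⊛-congˡ-≗ L (poch-unfoldˡ c m n) k ⟩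
  (((𝟙 ⊖ mono c m) ⊛ poch c (suc m) n) ⊛ L) k  ≡⟨ ⊛-assoc (𝟙 ⊖ mono c m) (poch c (suc m) n) L k ⟩
  ((𝟙 ⊖ mono c m) ⊛ (poch c (suc m) n ⊛ L)) k  ≡⟨ cong (λ x → ((𝟙 ⊖ mono c m) ⊛ (poch c (suc m) n ⊛ (𝟙 ⊖ mono c x))) k)
                                                       (ℕₚ.+-suc m n) ⟩
  ((𝟙 ⊖ mono c m) ⊛ poch c (suc m) (suc n)) k  ∎
  where
    open ≡-Reasoning
    L = 𝟙 ⊖ mono c (m + suc n)

poch-constant : ∀ c m n → poch c (suc m) n 0 ≡ + 1
poch-constant c m zero    = refl
poch-constant c m (suc n) rewrite poch-constant c m n = refl

poch-stable : ∀ {K} c m n j → K ≤ n → poch c (suc m) (n + j) ≈[ K ] poch c (suc m) n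
poch-stable c m n zero    K≤n rewrite ℕₚ.+-identityʳ n = ≈-refl
poch-stable {K} c m n (suc j) K≤n rewrite ℕₚ.+-suc n j = ≈-trans extraFactor (poch-stable c m n j K≤n)
  where
    P = poch c (suc m) (n + j)
    Q = mono c (suc m + (n + j))
    extraFactor : (P ⊛ (𝟙 ⊖ Q)) ≈[ K ] P
    extraFactor k k≤K = begin
      (P ⊛ (𝟙 ⊖ Q)) k            ≡⟨ ⊛-distribˡ-⊖ P 𝟙 Q k ⟩
      (P ⊛ 𝟙) k ℤ.- (P ⊛ Q) k    ≡⟨ cong₂ ℤ._-_ (⊛-identityʳ P k) (⊛-comm P Q k) ⟩
      P k ℤ.- (Q ⊛ P) k          ≡⟨ cong (λ x → P k ℤ.- x) (mono-⊛-≈𝟘 c (suc m + (n + j)) P K<exponent k k≤K) ⟩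
      P k ℤ.+ + 0                ≡⟨ ℤₚ.+-identityʳ (P k) ⟩
      P k                        ∎
      where
        open ≡-Reasoning
        K<exponent : K < suc m + (n + j)
        K<exponent = s≤s (ℕₚ.≤-trans (ℕₚ.≤-trans K≤n (ℕₚ.m≤m+n n j)) (ℕₚ.m≤n+m (n + j) m))

pochInf≈poch : ∀ c N → pochInf c 1 ≈[ N ] poch c 1 N
pochInf≈poch c N k k≤N = begin
  poch c 1 (suc k) k           ≡⟨ cong (λ x → poch c 1 x k) (ℕₚ.+-comm 1 k) ⟩
  poch c 1 (k + 1) k           ≡⟨ poch-stable c 0 k 1 ℕₚ.≤-refl k ℕₚ.≤-refl ⟩
  poch c 1 k k                 ≡⟨ sym (poch-stable c 0 k (N ∸ k) ℕₚ.≤-refl k ℕₚ.≤-refl) ⟩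
  poch c 1 (k + (N ∸ k)) k     ≡⟨ cong (λ x → poch c 1 x k) (ℕₚ.m+[n∸m]≡n k≤N) ⟩
  poch c 1 N k                 ∎
  where open ≡-Reasoning

poch-⊛-absorb : ∀ {K} c (F : ℕ → Series) → (∀ a → ((𝟙 ⊖ mono c (suc a)) ⊛ F a) ≈[ K ] F (suc a)) →
                ∀ a j → (poch c (suc a) j ⊛ F a) ≈[ K ] F (a + j)
poch-⊛-absorb c F step a zero rewrite ℕₚ.+-identityʳ a = ≗⇒≈ (⊛-identityˡ (F a))
poch-⊛-absorb {K} c F step a (suc j) = begin
  poch c (suc a) (suc j) ⊛ F a  ≈⟨ ≗⇒≈ (⊛-congˡ-≗ (F a) (poch-unfoldˡ c (suc a) j)) ⟩
  (L ⊛ P) ⊛ F a                 ≈⟨ ≗⇒≈ (⊛-congˡ-≗ (F a) (⊛-comm L P)) ⟩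
  (P ⊛ L) ⊛ F a                 ≈⟨ ≗⇒≈ (⊛-assoc P L (F a)) ⟩
  P ⊛ (L ⊛ F a)                 ≈⟨ ⊛-congʳ P (step a) ⟩
  P ⊛ F (suc a)                 ≈⟨ poch-⊛-absorb c F step (suc a) j ⟩
  F (suc a + j)                 ≡⟨ cong F (sym (ℕₚ.+-suc a j)) ⟩
  F (a + suc j)                 ∎
  where
    open SetoidReasoning (≈-setoid K)
    L = 𝟙 ⊖ mono c (suc a)
    P = poch c (suc (suc a)) j

poch-⊛-extract : ∀ {K} c (F : ℕ → Series) → (∀ s → F s ≈[ K ] ((𝟙 ⊖ mono c (suc s)) ⊛ F (suc s))) →
                 ∀ s j → F s ≈[ K ] (poch c (suc s) j ⊛ F (s + j))
poch-⊛-extract c F step s zero rewrite ℕₚ.+-identityʳ s = ≗⇒≈ (λ k → sym (⊛-identityˡ (F s) k))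
poch-⊛-extract {K} c F step s (suc j) = begin
  F s                                      ≈⟨ step s ⟩
  L ⊛ F (suc s)                            ≈⟨ ⊛-congʳ L (poch-⊛-extract c F step (suc s) j) ⟩
  L ⊛ (P ⊛ F (suc s + j))                  ≈⟨ ≗⇒≈ (λ k → sym (⊛-assoc L P (F (suc s + j)) k)) ⟩
  (L ⊛ P) ⊛ F (suc s + j)                  ≈⟨ ≗⇒≈ (⊛-congˡ-≗ (F (suc s + j)) (λ k → sym (poch-unfoldˡ c (suc s) j k))) ⟩
  poch c (suc s) (suc j) ⊛ F (suc s + j)   ≡⟨ cong (λ i → poch c (suc s) (suc j) ⊛ F i) (sym (ℕₚ.+-suc s j)) ⟩
  poch c (suc s) (suc j) ⊛ F (s + suc j)   ∎
  where
    open SetoidReasoning (≈-setoid K)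
    L = 𝟙 ⊖ mono c (suc s)
    P = poch c (suc (suc s)) j

Σₛ : ℕ → (ℕ → Series) → Series
Σₛ n F k = sumTo n (λ i → F i k)

Σₛ-cong : ∀ {K} n {F G : ℕ → Series} → (∀ i → i ≤ n → F i ≈[ K ] G i) → Σₛ n F ≈[ K ] Σₛ n G
Σₛ-cong n F≈G k k≤K = sumTo-cong n (λ i i≤n → F≈G i i≤n k k≤K)

Σₛ-cong-≗ : ∀ n {F G : ℕ → Series} → (∀ i → F i ≗ G i) → Σₛ n F ≗ Σₛ n G
Σₛ-cong-≗ n F≗G k = sumTo-ext n (λ i → F≗G i k)

⊛-distribʳ-Σₛ : ∀ n F g → (Σₛ n F ⊛ g) ≗ Σₛ n (λ i → F i ⊛ g)
⊛-distribʳ-Σₛ n F g k = begin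
  sumTo k (λ j → sumTo n (λ i → F i j) ℤ.* g (k ∸ j))
    ≡⟨ sumTo-ext k (λ j → trans (ℤₚ.*-comm _ (g (k ∸ j))) (sumTo-*ˡ n (g (k ∸ j)) (λ i → F i j))) ⟩
  sumTo k (λ j → sumTo n (λ i → g (k ∸ j) ℤ.* F i j))
    ≡⟨ sumTo-swap k n (λ j i → g (k ∸ j) ℤ.* F i j) ⟩
  sumTo n (λ i → sumTo k (λ j → g (k ∸ j) ℤ.* F i j))
    ≡⟨ sumTo-ext n (λ i → sumTo-ext k (λ j → ℤₚ.*-comm (g (k ∸ j)) (F i j))) ⟩
  sumTo n (λ i → (F i ⊛ g) k) ∎
  where open ≡-Reasoning

⊛-distribˡ-Σₛ : ∀ n g F → (g ⊛ Σₛ n F) ≗ Σₛ n (λ i → g ⊛ F i)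
⊛-distribˡ-Σₛ n g F k = trans (⊛-comm g (Σₛ n F) k)
  (trans (⊛-distribʳ-Σₛ n F g k) (sumTo-ext n (λ i → ⊛-comm (F i) g k)))

*ₗ-distrib-Σₛ : ∀ n c F → (c *ₗ Σₛ n F) ≗ Σₛ n (λ i → c *ₗ F i)
*ₗ-distrib-Σₛ n c F k = sumTo-*ˡ n c (λ i → F i k)

Σₛ-suc : ∀ n F → Σₛ (suc n) F ≗ (F 0 ⊕ Σₛ n (F ∘ suc))
Σₛ-suc n F k = sumTo-suc n (λ i → F i k)

Σₛ-swap : ∀ n m (F : ℕ → ℕ → Series) → Σₛ n (λ i → Σₛ m (F i)) ≗ Σₛ m (λ j → Σₛ n (λ i → F i j))
Σₛ-swap n m F k = sumTo-swap n m (λ i j → F i j k)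

Σₛ-⊖ : ∀ n F G → (Σₛ n F ⊖ Σₛ n G) ≗ Σₛ n (λ i → F i ⊖ G i)
Σₛ-⊖ n F G k = trans (cong (ℤ._+_ (Σₛ n F k)) (sumTo-neg n (λ i → G i k)))
  (sym (sumTo-+ n (λ i → F i k) (λ i → - G i k)))

Σₛ-dropLast : ∀ {K} n F → F (suc n) ≈[ K ] 𝟘 → Σₛ (suc n) F ≈[ K ] Σₛ n F
Σₛ-dropLast n F last≈𝟘 k k≤K = trans (cong (ℤ._+_ (Σₛ n F k)) (last≈𝟘 k k≤K)) (ℤₚ.+-identityʳ _)

Σₛ-≈head : ∀ {K} n F → (∀ i → i ≤ n → F (suc i) ≈[ K ] 𝟘) → Σₛ (suc n) F ≈[ K ] F 0
Σₛ-≈head n F tail≈𝟘 k k≤K = begin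
  Σₛ (suc n) F k                 ≡⟨ Σₛ-suc n F k ⟩
  F 0 k ℤ.+ Σₛ n (F ∘ suc) k     ≡⟨ cong (ℤ._+_ (F 0 k)) (sumTo-cong n (λ i i≤n → tail≈𝟘 i i≤n k k≤K)) ⟩
  F 0 k ℤ.+ sumTo n (λ _ → + 0)  ≡⟨ cong (ℤ._+_ (F 0 k)) (sumTo-zero n) ⟩
  F 0 k ℤ.+ + 0                  ≡⟨ ℤₚ.+-identityʳ _ ⟩
  F 0 k                          ∎
  where open ≡-Reasoning

-- Term by term the difference carries a factor 1 - q^m, which turns X m into X (m - 1);
-- the m = 0 term vanishes, and the new last term is invisible modulo q^{n+2}.
alternating-telescope : ∀ n (X : ℕ → Series) (e f : ℕ → ℕ) d →
  (∀ t → t ≤ n → ((𝟙 ⊖ mono (+ 1) (suc t)) ⊛ X (suc t)) ≗ X t) →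
  (∀ t → e (suc t) ≡ d + f t) → suc n < d + f (suc n) →
  (Σₛ (suc n) (λ m → mono (sgn m) (e m) ⊛ X m) ⊖ Σₛ (suc n) (λ m → mono (sgn m) (m + e m) ⊛ X m))
    ≈[ suc n ] (mono (- + 1) d ⊛ Σₛ (suc n) (λ m → mono (sgn m) (f m) ⊛ X m))
alternating-telescope n X e f d X-step e-suc d+f-large = begin
  Σₛ K A ⊖ Σₛ K B                       ≈⟨ ≗⇒≈ (Σₛ-⊖ K A B) ⟩
  Σₛ K (λ m → A m ⊖ B m)                ≈⟨ ≗⇒≈ (Σₛ-cong-≗ K (λ m → mono-⊛-⊖ (sgn m) (e m) m (X m))) ⟩
  Σₛ K D                                ≈⟨ ≗⇒≈ (Σₛ-suc n D) ⟩
  D 0 ⊕ Σₛ n (D ∘ suc)                  ≈⟨ ≗⇒≈ (λ k → trans (cong (ℤ._+ Σₛ n (D ∘ suc) k) (D-zero k)) (ℤₚ.+-identityˡ _)) ⟩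
  Σₛ n (D ∘ suc)                        ≈⟨ Σₛ-cong n (λ t t≤n → ≗⇒≈ (D-suc t t≤n)) ⟩
  Σₛ n (λ t → mono (- + 1) d ⊛ C t)     ≈⟨ ≈-sym (Σₛ-dropLast n (λ t → mono (- + 1) d ⊛ C t) last≈𝟘) ⟩
  Σₛ K (λ t → mono (- + 1) d ⊛ C t)     ≈⟨ ≗⇒≈ (λ k → sym (⊛-distribˡ-Σₛ K (mono (- + 1) d) C k)) ⟩
  mono (- + 1) d ⊛ Σₛ K C               ∎
  where
    open SetoidReasoning (≈-setoid (suc n))
    K = suc n
    A B C D : ℕ → Series
    A m = mono (sgn m) (e m) ⊛ X m
    B m = mono (sgn m) (m + e m) ⊛ X m
    C m = mono (sgn m) (f m) ⊛ X m
    D m = mono (sgn m) (e m) ⊛ ((𝟙 ⊖ mono (+ 1) m) ⊛ X m)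
    D-zero : D 0 ≗ 𝟘
    D-zero k = trans (⊛-congʳ-≗ (mono (+ 1) (e 0)) (λ j → trans (⊛-congˡ-≗ (X 0) 𝟙⊖mono-0 j) (⊛-zeroˡ (X 0) j)) k)
                     (⊛-zeroʳ (mono (+ 1) (e 0)) k)
    D-suc : ∀ t → t ≤ n → D (suc t) ≗ (mono (- + 1) d ⊛ C t)
    D-suc t t≤n k = trans (⊛-congʳ-≗ (mono (sgn (suc t)) (e (suc t))) (X-step t t≤n) k)
      (trans (cong₂ (λ c x → (mono c x ⊛ X t) k) (sym (ℤₚ.-1*i≡-i (sgn t))) (e-suc t))
             (sym (mono-⊛-mono-⊛ (- + 1) (sgn t) d (f t) (X t) k)))
    last≈𝟘 : (mono (- + 1) d ⊛ C K) ≈[ K ] 𝟘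
    last≈𝟘 = ≈-trans (≗⇒≈ (mono-⊛-mono-⊛ (- + 1) (sgn K) d (f K) (X K)))
                     (mono-⊛-≈𝟘 (- + 1 ℤ.* sgn K) (d + f K) (X K) d+f-large)

-- Partitions into distinct parts by smallest part

gf : (List ℕ → ℤ) → List (List ℕ) → Series
gf w Ls N = foldr ℤ._+_ (+ 0) (map w (filter (λ π → sumℕ π ℕ.≟ N) Ls))

gf-accept : ∀ w S Ls {N} → sumℕ S ≡ N → gf w (S ∷ Ls) N ≡ w S ℤ.+ gf w Ls N
gf-accept w S Ls {N} ΣS≡N = cong (foldr ℤ._+_ (+ 0) ∘ map w) (filter-accept (λ π → sumℕ π ℕ.≟ N) {S} {Ls} ΣS≡N)

gf-reject : ∀ w S Ls {N} → sumℕ S ≢ N → gf w (S ∷ Ls) N ≡ gf w Ls N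
gf-reject w S Ls {N} ΣS≢N = cong (foldr ℤ._+_ (+ 0) ∘ map w) (filter-reject (λ π → sumℕ π ℕ.≟ N) {S} {Ls} ΣS≢N)

gf-[] : ∀ w → w [] ≡ + 1 → gf w ([] ∷ []) ≗ 𝟙
gf-[] w w[]≡1 zero    = trans (ℤₚ.+-identityʳ _) w[]≡1
gf-[] w w[]≡1 (suc N) = refl

gf-++ : ∀ w Ls Ms → gf w (Ls ++ Ms) ≗ (gf w Ls ⊕ gf w Ms)
gf-++ w []       Ms N = sym (ℤₚ.+-identityˡ _)
gf-++ w (S ∷ Ls) Ms N with sumℕ S ℕ.≟ N
... | yes ΣS≡N = begin
  gf w (S ∷ Ls ++ Ms) N                 ≡⟨ gf-accept w S (Ls ++ Ms) ΣS≡N ⟩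
  w S ℤ.+ gf w (Ls ++ Ms) N             ≡⟨ cong (ℤ._+_ (w S)) (gf-++ w Ls Ms N) ⟩
  w S ℤ.+ (gf w Ls N ℤ.+ gf w Ms N)     ≡⟨ sym (ℤₚ.+-assoc (w S) _ _) ⟩
  w S ℤ.+ gf w Ls N ℤ.+ gf w Ms N       ≡⟨ cong (ℤ._+ gf w Ms N) (sym (gf-accept w S Ls ΣS≡N)) ⟩
  gf w (S ∷ Ls) N ℤ.+ gf w Ms N         ∎
  where open ≡-Reasoning
... | no ΣS≢N = trans (gf-reject w S (Ls ++ Ms) ΣS≢N)
  (trans (gf-++ w Ls Ms N) (cong (ℤ._+ gf w Ms N) (sym (gf-reject w S Ls ΣS≢N))))

gf-∷-< : ∀ w x Ls {N} → N < x → gf w (map (x ∷_) Ls) N ≡ + 0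
gf-∷-< w x []       N<x = refl
gf-∷-< w x (S ∷ Ls) N<x =
  trans (gf-reject w (x ∷ S) (map (x ∷_) Ls)
                   (λ x+ΣS≡N → ℕₚ.<⇒≱ N<x (subst (x ≤_) x+ΣS≡N (ℕₚ.m≤m+n x (sumℕ S)))))
        (gf-∷-< w x Ls N<x)

gf-∷-+ : ∀ w x Ls j → gf w (map (x ∷_) Ls) (x + j) ≡ gf (w ∘ (x ∷_)) Ls j
gf-∷-+ w x []       j = refl
gf-∷-+ w x (S ∷ Ls) j with sumℕ S ℕ.≟ j
... | yes ΣS≡j = trans (gf-accept w (x ∷ S) (map (x ∷_) Ls) (cong (_+_ x) ΣS≡j))
  (trans (cong (ℤ._+_ (w (x ∷ S))) (gf-∷-+ w x Ls j)) (sym (gf-accept (w ∘ (x ∷_)) S Ls ΣS≡j)))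
... | no ΣS≢j = trans (gf-reject w (x ∷ S) (map (x ∷_) Ls) (λ e → ΣS≢j (ℕₚ.+-cancelˡ-≡ x _ _ e)))
  (trans (gf-∷-+ w x Ls j) (sym (gf-reject (w ∘ (x ∷_)) S Ls ΣS≢j)))

gf-map-∷ : ∀ w x Ls → gf w (map (x ∷_) Ls) ≗ (mono (+ 1) x ⊛ gf (w ∘ (x ∷_)) Ls)
gf-map-∷ w x Ls N with offset x N
... | below N<x = trans (gf-∷-< w x Ls N<x) (sym (mono-⊛-< (+ 1) x (gf (w ∘ (x ∷_)) Ls) N<x))
... | above j   = trans (gf-∷-+ w x Ls j)
  (sym (trans (mono-⊛-+ (+ 1) x (gf (w ∘ (x ∷_)) Ls) j) (ℤₚ.*-identityˡ _)))

gf-sublists-∷ : ∀ w x xs →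
  gf w (sublists (x ∷ xs)) ≗ ((mono (+ 1) x ⊛ gf (w ∘ (x ∷_)) (sublists xs)) ⊕ gf w (sublists xs))
gf-sublists-∷ w x xs N = trans (gf-++ w (map (x ∷_) (sublists xs)) (sublists xs) N)
  (cong (ℤ._+ gf w (sublists xs) N) (gf-map-∷ w x (sublists xs) N))

gf-*ₗ : ∀ c w w′ Ls → All (λ S → w′ S ≡ c ℤ.* w S) Ls → gf w′ Ls ≗ (c *ₗ gf w Ls)
gf-*ₗ c w w′ []       []            N = sym (ℤₚ.*-zeroʳ c)
gf-*ₗ c w w′ (S ∷ Ls) (w′S≡ ∷ w′≡) N with sumℕ S ℕ.≟ N
... | yes ΣS≡N = begin
  gf w′ (S ∷ Ls) N                      ≡⟨ gf-accept w′ S Ls ΣS≡N ⟩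
  w′ S ℤ.+ gf w′ Ls N                   ≡⟨ cong₂ ℤ._+_ w′S≡ (gf-*ₗ c w w′ Ls w′≡ N) ⟩
  c ℤ.* w S ℤ.+ c ℤ.* gf w Ls N         ≡⟨ sym (ℤₚ.*-distribˡ-+ c (w S) _) ⟩
  c ℤ.* (w S ℤ.+ gf w Ls N)             ≡⟨ cong (c ℤ.*_) (sym (gf-accept w S Ls ΣS≡N)) ⟩
  c ℤ.* gf w (S ∷ Ls) N                 ∎
  where open ≡-Reasoning
... | no ΣS≢N = trans (gf-reject w′ S Ls ΣS≢N)
  (trans (gf-*ₗ c w w′ Ls w′≡ N) (cong (c ℤ.*_) (sym (gf-reject w S Ls ΣS≢N))))

range : ℕ → ℕ → List ℕ
range a zero    = []
range a (suc n) = a ∷ range (suc a) n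

applyUpTo≡range : ∀ (f : ℕ → ℕ) a n → (∀ i → f i ≡ a + i) → applyUpTo f n ≡ range a n
applyUpTo≡range f a zero    f≡ = refl
applyUpTo≡range f a (suc n) f≡ = cong₂ _∷_ (trans (f≡ 0) (ℕₚ.+-identityʳ a))
  (applyUpTo≡range (f ∘ suc) (suc a) n (λ i → trans (f≡ (suc i)) (ℕₚ.+-suc a i)))

All-≤-range : ∀ a n → All (a ≤_) (range a n)
All-≤-range a zero    = []
All-≤-range a (suc n) = ℕₚ.≤-refl ∷ All.map ℕₚ.<⇒≤ (All-≤-range (suc a) n)

All-sublists : ∀ {P : ℕ → Set} xs → All P xs → All (All P) (sublists xs)
All-sublists []       []         = [] ∷ []
All-sublists (x ∷ xs) (px ∷ pxs) =
  Allₚ.++⁺ (Allₚ.map⁺ (All.map (px ∷_) (All-sublists xs pxs))) (All-sublists xs pxs)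

signWeight : List ℕ → ℤ
signWeight S = sgn (length S)

dWeight : List ℕ → ℤ
dWeight π = sgnℤ (+ numParts π ℤ.- + smallest π)

sgnℤ-difference : ∀ a b → sgnℤ (+ a ℤ.- + b) ≡ sgn a ℤ.* sgn b
sgnℤ-difference zero    zero    = refl
sgnℤ-difference zero    (suc b) = sym (ℤₚ.*-identityˡ (sgn (suc b)))
sgnℤ-difference (suc a) zero    = trans (cong (sgn ∘ suc) (ℕₚ.+-identityʳ a)) (sym (ℤₚ.*-identityʳ _))
sgnℤ-difference (suc a) (suc b) =
  trans (cong sgnℤ (trans (ℤₚ.[1+m]⊖[1+n]≡m⊖n a b) (sym (ℤₚ.m-n≡m⊖n a b))))
        (trans (sgnℤ-difference a b) (solve 2 (λ x y → x :* y := (:- x) :* (:- y)) refl (sgn a) (sgn b)))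
  where open +-*-Solver

smallest-∷ : ∀ x S → All (x ≤_) S → smallest (x ∷ S) ≡ x
smallest-∷ x []      []            = refl
smallest-∷ x (y ∷ S) (x≤y ∷ x≤S) rewrite smallest-∷ x S x≤S = ℕₚ.m≥n⇒m⊓n≡n x≤y

dWeight-∷ : ∀ x S → All (x ≤_) S → dWeight (x ∷ S) ≡ (- sgn x) ℤ.* signWeight S
dWeight-∷ x S x≤S = begin
  sgnℤ (+ suc (length S) ℤ.- + smallest (x ∷ S))  ≡⟨ cong (λ y → sgnℤ (+ suc (length S) ℤ.- + y)) (smallest-∷ x S x≤S) ⟩
  sgnℤ (+ suc (length S) ℤ.- + x)                 ≡⟨ sgnℤ-difference (suc (length S)) x ⟩
  (- sgn (length S)) ℤ.* sgn x                    ≡⟨ solve 2 (λ y z → (:- y) :* z := (:- z) :* y) refl (sgn (length S)) (sgn x) ⟩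
  (- sgn x) ℤ.* sgn (length S)                    ∎
  where
    open ≡-Reasoning
    open +-*-Solver

gf-signWeight-range : ∀ a n → gf signWeight (sublists (range (suc a) n)) ≗ poch (+ 1) (suc a) n
gf-signWeight-range a zero      = gf-[] signWeight refl
gf-signWeight-range a (suc n) N = begin
  gf signWeight (sublists (x ∷ xs)) N
    ≡⟨ gf-sublists-∷ signWeight x xs N ⟩
  (mono (+ 1) x ⊛ gf (signWeight ∘ (x ∷_)) L) N ℤ.+ G N
    ≡⟨ cong (ℤ._+ G N) (⊛-congʳ-≗ (mono (+ 1) x) (gf-*ₗ (- + 1) signWeight (signWeight ∘ (x ∷_)) L
                          (All.universal (λ S → sym (ℤₚ.-1*i≡-i (signWeight S))) L)) N) ⟩
  (mono (+ 1) x ⊛ ((- + 1) *ₗ G)) N ℤ.+ G N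
    ≡⟨ cong (ℤ._+ G N) (⊛-*ₗ (- + 1) (mono (+ 1) x) G N) ⟩
  (- + 1) ℤ.* (mono (+ 1) x ⊛ G) N ℤ.+ G N
    ≡⟨ solve 2 (λ u v → (:- con (+ 1)) :* u :+ v := v :- u) refl ((mono (+ 1) x ⊛ G) N) (G N) ⟩
  G N ℤ.- (mono (+ 1) x ⊛ G) N
    ≡⟨ sym (𝟙⊖f-⊛ (mono (+ 1) x) G N) ⟩
  ((𝟙 ⊖ mono (+ 1) x) ⊛ G) N
    ≡⟨ ⊛-congʳ-≗ (𝟙 ⊖ mono (+ 1) x) (gf-signWeight-range x n) N ⟩
  ((𝟙 ⊖ mono (+ 1) x) ⊛ poch (+ 1) (suc x) n) N
    ≡⟨ sym (poch-unfoldˡ (+ 1) x n N) ⟩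
  poch (+ 1) x (suc n) N ∎
  where
    open ≡-Reasoning
    open +-*-Solver
    x  = suc a
    xs = range (suc x) n
    L  = sublists xs
    G  = gf signWeight L

-- generating function, weighted by (-1)^{#(π)-s}, of the π with smallest part s and other parts in (s, s + j]
smallestPartTerm : ℕ → ℕ → Series
smallestPartTerm s j = (- sgn s) *ₗ (mono (+ 1) s ⊛ poch (+ 1) (suc s) j)

smallestPartSum : ℕ → ℕ → Series
smallestPartSum a zero    = 𝟘
smallestPartSum a (suc n) = smallestPartTerm a n ⊕ smallestPartSum (suc a) n

gf-dWeight-range : ∀ a n → gf dWeight (sublists (range (suc a) n)) ≗ (𝟙 ⊕ smallestPartSum (suc a) n)
gf-dWeight-range a zero    k = trans (gf-[] dWeight refl k) (sym (ℤₚ.+-identityʳ (𝟙 k)))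
gf-dWeight-range a (suc n) N = begin
  gf dWeight (sublists (x ∷ xs)) N
    ≡⟨ gf-sublists-∷ dWeight x xs N ⟩
  (mono (+ 1) x ⊛ gf (dWeight ∘ (x ∷_)) L) N ℤ.+ gf dWeight L N
    ≡⟨ cong₂ ℤ._+_ (trans (⊛-congʳ-≗ (mono (+ 1) x) tailWeights N)
                          (⊛-*ₗ (- sgn x) (mono (+ 1) x) (poch (+ 1) (suc x) n) N))
                   (gf-dWeight-range (suc a) n N) ⟩
  smallestPartTerm x n N ℤ.+ (𝟙 N ℤ.+ smallestPartSum (suc x) n N)
    ≡⟨ solve 3 (λ p q r → p :+ (q :+ r) := q :+ (p :+ r)) refl (smallestPartTerm x n N) (𝟙 N) _ ⟩
  𝟙 N ℤ.+ (smallestPartTerm x n N ℤ.+ smallestPartSum (suc x) n N) ∎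
  where
    open ≡-Reasoning
    open +-*-Solver
    x  = suc a
    xs = range (suc x) n
    L  = sublists xs
    tailWeights : gf (dWeight ∘ (x ∷_)) L ≗ ((- sgn x) *ₗ poch (+ 1) (suc x) n)
    tailWeights k = trans
      (gf-*ₗ (- sgn x) signWeight (dWeight ∘ (x ∷_)) L
        (All.map (λ {S} → dWeight-∷ x S) (All-sublists xs (All.map ℕₚ.<⇒≤ (All-≤-range (suc x) n)))) k)
      (cong ((- sgn x) ℤ.*_) (gf-signWeight-range x n k))

dcount≡smallestPartSum : ∀ n → dcount (suc n) ≡ smallestPartSum 1 (suc n) (suc n)
dcount≡smallestPartSum n = begin
  gf dWeight (sublists (applyUpTo suc (suc n))) (suc n)
    ≡⟨ cong (λ l → gf dWeight (sublists l) (suc n)) (applyUpTo≡range suc 1 (suc n) (λ _ → refl)) ⟩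
  gf dWeight (sublists (range 1 (suc n))) (suc n)
    ≡⟨ gf-dWeight-range 0 (suc n) (suc n) ⟩
  + 0 ℤ.+ smallestPartSum 1 (suc n) (suc n)
    ≡⟨ ℤₚ.+-identityˡ _ ⟩
  smallestPartSum 1 (suc n) (suc n) ∎
  where open ≡-Reasoning

-- The sums Σ_s (-1)^s q^{as} (q^{s+1};q)_∞

-- (q^{s+1};q)_{K-s}: the factors of (q^{s+1};q)_∞ that are visible modulo q^{K+1}
tailPoch : ℕ → ℕ → Series
tailPoch K s = poch (+ 1) (suc s) (K ∸ s)

tailPoch-step : ∀ n t → t ≤ n → ((𝟙 ⊖ mono (+ 1) (suc t)) ⊛ tailPoch (suc n) (suc t)) ≗ tailPoch (suc n) t
tailPoch-step n t t≤n k = trans (sym (poch-unfoldˡ (+ 1) (suc t) (n ∸ t) k))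
  (cong (λ m → poch (+ 1) (suc t) m k) (sym (ℕₚ.+-∸-assoc 1 t≤n)))

tailTerm : ℕ → ℕ → ℕ → Series
tailTerm K a s = mono (sgn s) (a * s) ⊛ tailPoch K s

tailSum : ℕ → ℕ → Series
tailSum K a = Σₛ K (tailTerm K a)

tailSum-step : ∀ n a →
  tailSum (suc n) (suc (suc a)) ≈[ suc n ] ((𝟙 ⊖ mono (- + 1) (suc a)) ⊛ tailSum (suc n) (suc a))
tailSum-step n a = begin
  tailSum K (suc A)
    ≈⟨ ⊖≈⇒≈⊖ (tailSum K A) _ _
         (alternating-telescope n (tailPoch K) (A *_) (A *_) A (tailPoch-step n) (ℕₚ.*-suc A) large) ⟩
  tailSum K A ⊖ (mono (- + 1) A ⊛ tailSum K A)
    ≈⟨ ≗⇒≈ (λ k → sym (𝟙⊖f-⊛ (mono (- + 1) A) (tailSum K A) k)) ⟩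
  (𝟙 ⊖ mono (- + 1) A) ⊛ tailSum K A ∎
  where
    open SetoidReasoning (≈-setoid (suc n))
    K = suc n
    A = suc a
    large : suc n < A + A * suc n
    large = s≤s (ℕₚ.≤-trans (ℕₚ.m≤m+n (suc n) (a * suc n)) (ℕₚ.m≤n+m _ a))

tailSum-top : ∀ n → tailSum (suc n) (suc (suc n)) ≈[ suc n ] poch (+ 1) 1 (suc n)
tailSum-top n = ≈-trans (Σₛ-≈head n (tailTerm K (suc K)) higher≈𝟘)
  (≗⇒≈ (λ k → trans (cong (λ x → (mono (+ 1) x ⊛ tailPoch K 0) k) (ℕₚ.*-zeroʳ (suc K))) (mono-0-⊛ (tailPoch K 0) k)))
  where
    K = suc n
    higher≈𝟘 : ∀ i → i ≤ n → tailTerm K (suc K) (suc i) ≈[ K ] 𝟘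
    higher≈𝟘 i _ = mono-⊛-≈𝟘 (sgn (suc i)) (suc K * suc i) (tailPoch K (suc i))
                            (ℕₚ.≤-trans (ℕₚ.n<1+n K) (ℕₚ.m≤m*n (suc K) (suc i)))

tailSum-one : ∀ n → tailSum (suc n) 1 ≈[ suc n ] (poch (+ 1) 1 (suc n) ⊘ poch (- + 1) 1 (suc n))
tailSum-one n = ⊘-unique (tailSum K 1) (poch (- + 1) 1 K) (poch (+ 1) 1 K) (poch-constant (- + 1) 0 K)
  (≈-trans (≗⇒≈ (⊛-comm (tailSum K 1) (poch (- + 1) 1 K)))
  (≈-trans (poch-⊛-absorb (- + 1) (tailSum K ∘ suc) (λ a → ≈-sym (tailSum-step n a)) 0 K)
           (tailSum-top n)))
  where K = suc n

smallestPartSum-Σₛ : ∀ a n → smallestPartSum a (suc n) ≗ Σₛ n (λ i → smallestPartTerm (a + i) (n ∸ i))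
smallestPartSum-Σₛ a zero    k rewrite ℕₚ.+-identityʳ a = ℤₚ.+-identityʳ _
smallestPartSum-Σₛ a (suc n) k = begin
  smallestPartTerm a (suc n) k ℤ.+ smallestPartSum (suc a) (suc n) k
    ≡⟨ cong₂ ℤ._+_ (cong (λ b → smallestPartTerm b (suc n) k) (sym (ℕₚ.+-identityʳ a))) (smallestPartSum-Σₛ (suc a) n k) ⟩
  smallestPartTerm (a + 0) (suc n) k ℤ.+ Σₛ n (λ i → smallestPartTerm (suc a + i) (n ∸ i)) k
    ≡⟨ cong (ℤ._+_ (smallestPartTerm (a + 0) (suc n) k))
            (sumTo-ext n (λ i → cong (λ b → smallestPartTerm b (n ∸ i) k) (sym (ℕₚ.+-suc a i)))) ⟩
  smallestPartTerm (a + 0) (suc n) k ℤ.+ Σₛ n (λ i → smallestPartTerm (a + suc i) (suc n ∸ suc i)) k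
    ≡⟨ sym (Σₛ-suc n (λ i → smallestPartTerm (a + i) (suc n ∸ i)) k) ⟩
  Σₛ (suc n) (λ i → smallestPartTerm (a + i) (suc n ∸ i)) k ∎
  where open ≡-Reasoning

smallestPartTerm≡-tailTerm : ∀ n i → smallestPartTerm (suc i) (n ∸ i) ≗ (λ k → - tailTerm (suc n) 1 (suc i) k)
smallestPartTerm≡-tailTerm n i k = begin
  (- sgn (suc i)) ℤ.* (mono (+ 1) (suc i) ⊛ P) k  ≡⟨ sym (ℤₚ.neg-distribˡ-* (sgn (suc i)) _) ⟩
  - (sgn (suc i) ℤ.* (mono (+ 1) (suc i) ⊛ P) k)  ≡⟨ cong -_ (sym (mono-⊛-*ₗ (sgn (suc i)) (suc i) P k)) ⟩
  - (mono (sgn (suc i)) (suc i) ⊛ P) k            ≡⟨ cong (λ e → - (mono (sgn (suc i)) e ⊛ P) k) (sym (ℕₚ.*-identityˡ (suc i))) ⟩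
  - tailTerm (suc n) 1 (suc i) k                  ∎
  where
    open ≡-Reasoning
    P = tailPoch (suc n) (suc i)

smallestPartSum≡poch⊖tailSum : ∀ n → smallestPartSum 1 (suc n) ≗ (poch (+ 1) 1 (suc n) ⊖ tailSum (suc n) 1)
smallestPartSum≡poch⊖tailSum n k = begin
  smallestPartSum 1 (suc n) k                      ≡⟨ smallestPartSum-Σₛ 1 n k ⟩
  Σₛ n (λ i → smallestPartTerm (suc i) (n ∸ i)) k  ≡⟨ sumTo-ext n (λ i → smallestPartTerm≡-tailTerm n i k) ⟩
  sumTo n (λ i → - tailTerm K 1 (suc i) k)         ≡⟨ sym (sumTo-neg n (λ i → tailTerm K 1 (suc i) k)) ⟩
  - S                                              ≡⟨ solve 2 (λ q s → :- s := q :- (q :+ s)) refl Q S ⟩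
  Q ℤ.- (Q ℤ.+ S)                                  ≡⟨ cong (λ u → Q ℤ.- (u ℤ.+ S)) (sym (mono-0-⊛ (tailPoch K 0) k)) ⟩
  Q ℤ.- (tailTerm K 1 0 k ℤ.+ S)                   ≡⟨ cong (ℤ._-_ Q) (sym (Σₛ-suc n (tailTerm K 1) k)) ⟩
  Q ℤ.- tailSum K 1 k                              ∎
  where
    open ≡-Reasoning
    open +-*-Solver
    K = suc n
    Q = poch (+ 1) 1 K k
    S = sumTo n (λ i → tailTerm K 1 (suc i) k)

-- Euler's identity (q^{s+1};q)_∞ = Σ_m (-1)^m q^{sm + m(m+1)/2} / (q;q)_m

tri : ℕ → ℕ
tri zero    = 0
tri (suc m) = suc m + tri m

tri-shift : ∀ s t → s * suc t + tri (suc t) ≡ suc s + (suc s * t + tri t)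
tri-shift s t = solve 3 (λ s t r → s :* (con 1 :+ t) :+ ((con 1 :+ t) :+ r) := (con 1 :+ s) :+ ((con 1 :+ s) :* t :+ r))
                refl s t (tri t)
  where open ℕ-Solver.+-*-Solver

qPochInv : ℕ → Series
qPochInv m = inv (poch (+ 1) 1 m)

qPochInv-step : ∀ m → ((𝟙 ⊖ mono (+ 1) (suc m)) ⊛ qPochInv (suc m)) ≗ qPochInv m
qPochInv-step m k = begin
  (L ⊛ inv (Q ⊛ L)) k           ≡⟨ ⊛-congʳ-≗ L (inv-⊛ Q L (poch-constant (+ 1) 0 m) refl) k ⟩
  (L ⊛ (qPochInv m ⊛ inv L)) k  ≡⟨ sym (⊛-assoc L (qPochInv m) (inv L) k) ⟩
  ((L ⊛ qPochInv m) ⊛ inv L) k  ≡⟨ ⊛-congˡ-≗ (inv L) (⊛-comm L (qPochInv m)) k ⟩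
  ((qPochInv m ⊛ L) ⊛ inv L) k  ≡⟨ ⊛-assoc (qPochInv m) L (inv L) k ⟩
  (qPochInv m ⊛ (L ⊛ inv L)) k  ≡⟨ ⊛-congʳ-≗ (qPochInv m) (⊛-inverseʳ L refl) k ⟩
  (qPochInv m ⊛ 𝟙) k            ≡⟨ ⊛-identityʳ (qPochInv m) k ⟩
  qPochInv m k                  ∎
  where
    open ≡-Reasoning
    Q = poch (+ 1) 1 m
    L = 𝟙 ⊖ mono (+ 1) (suc m)

eulerTerm : ℕ → ℕ → Series
eulerTerm s m = mono (sgn m) (s * m + tri m) ⊛ qPochInv m

eulerSum : ℕ → ℕ → Series
eulerSum K s = Σₛ K (eulerTerm s)

eulerSum-step : ∀ n s → eulerSum (suc n) s ≈[ suc n ] ((𝟙 ⊖ mono (+ 1) (suc s)) ⊛ eulerSum (suc n) (suc s))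
eulerSum-step n s = begin
  eulerSum K s
    ≈⟨ ⊖≈⇒≈⊕ (eulerSum K s) (eulerSum K (suc s)) _ telescoped ⟩
  eulerSum K (suc s) ⊕ (mono (- + 1) (suc s) ⊛ eulerSum K (suc s))
    ≈⟨ ≗⇒≈ (λ k → sym (𝟙⊕f-⊛ (mono (- + 1) (suc s)) (eulerSum K (suc s)) k)) ⟩
  (𝟙 ⊕ mono (- + 1) (suc s)) ⊛ eulerSum K (suc s)
    ≈⟨ ≗⇒≈ (⊛-congˡ-≗ (eulerSum K (suc s)) (𝟙⊕mono-neg (suc s))) ⟩
  (𝟙 ⊖ mono (+ 1) (suc s)) ⊛ eulerSum K (suc s) ∎
  where
    open SetoidReasoning (≈-setoid (suc n))
    K = suc n
    large : suc n < suc s + (suc s * suc n + tri (suc n))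
    large = s≤s (ℕₚ.≤-trans (ℕₚ.≤-trans (ℕₚ.m≤n*m (suc n) (suc s)) (ℕₚ.m≤m+n _ (tri (suc n)))) (ℕₚ.m≤n+m _ s))
    telescoped : (eulerSum K s ⊖ eulerSum K (suc s)) ≈[ K ] (mono (- + 1) (suc s) ⊛ eulerSum K (suc s))
    telescoped = ≈-trans
      (≗⇒≈ (λ k → cong (ℤ._-_ (eulerSum K s k))
        (Σₛ-cong-≗ K (λ m → ⊛-congˡ-≗ (qPochInv m)
                       (λ j → cong (λ x → mono (sgn m) x j) (ℕₚ.+-assoc m (s * m) (tri m)))) k)))
      (alternating-telescope n qPochInv (λ m → s * m + tri m) (λ m → suc s * m + tri m) (suc s)
                             (λ t _ → qPochInv-step t) (tri-shift s) large)

eulerSum-top : ∀ n → eulerSum (suc n) (suc n) ≈[ suc n ] 𝟙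
eulerSum-top n = ≈-trans (Σₛ-≈head n (eulerTerm K) higher≈𝟘)
  (≗⇒≈ (λ k → trans (cong (λ x → (mono (+ 1) x ⊛ qPochInv 0) k) (trans (ℕₚ.+-identityʳ (K * 0)) (ℕₚ.*-zeroʳ K)))
                    (trans (mono-0-⊛ (qPochInv 0) k) (inv-𝟙 k))))
  where
    K = suc n
    higher≈𝟘 : ∀ t → t ≤ n → eulerTerm K (suc t) ≈[ K ] 𝟘
    higher≈𝟘 t _ = mono-⊛-≈𝟘 (sgn (suc t)) (K * suc t + tri (suc t)) (qPochInv (suc t))
      (ℕₚ.≤-trans (s≤s (ℕₚ.≤-trans (ℕₚ.m≤m*n K (suc t)) (ℕₚ.m≤m+n _ (t + tri t))))
                  (ℕₚ.≤-reflexive (sym (ℕₚ.+-suc (K * suc t) (t + tri t)))))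

tailPoch≈eulerSum : ∀ n s → s ≤ suc n → tailPoch (suc n) s ≈[ suc n ] eulerSum (suc n) s
tailPoch≈eulerSum n s s≤K = ≈-sym (begin
  eulerSum K s                                 ≈⟨ poch-⊛-extract (+ 1) (eulerSum K) (eulerSum-step n) s (K ∸ s) ⟩
  tailPoch K s ⊛ eulerSum K (s + (K ∸ s))      ≡⟨ cong (λ i → tailPoch K s ⊛ eulerSum K i) (ℕₚ.m+[n∸m]≡n s≤K) ⟩
  tailPoch K s ⊛ eulerSum K K                  ≈⟨ ⊛-congʳ (tailPoch K s) (eulerSum-top n) ⟩
  tailPoch K s ⊛ 𝟙                             ≈⟨ ≗⇒≈ (⊛-identityʳ (tailPoch K s)) ⟩
  tailPoch K s                                 ∎)
  where
    open SetoidReasoning (≈-setoid (suc n))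
    K = suc n

-- Both sides as the double sum Σ_{t,m} (-1)^{t+m} q^{(t+1)(m+1) + m(m+1)/2} / (q;q)_m

doubleSumTerm : ℕ → ℕ → Series
doubleSumTerm t m = mono (sgn t ℤ.* sgn m) (suc t + (suc t * m + tri m)) ⊛ qPochInv m

smallestPartTerm≈doubleSum : ∀ n i → i ≤ n → smallestPartTerm (suc i) (n ∸ i) ≈[ suc n ] Σₛ n (doubleSumTerm i)
smallestPartTerm≈doubleSum n i i≤n = begin
  c *ₗ (mono (+ 1) (suc i) ⊛ tailPoch K (suc i))
    ≈⟨ (λ k k≤K → cong (c ℤ.*_) (⊛-congʳ (mono (+ 1) (suc i)) (tailPoch≈eulerSum n (suc i) (s≤s i≤n)) k k≤K)) ⟩
  c *ₗ (mono (+ 1) (suc i) ⊛ eulerSum K (suc i))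
    ≈⟨ ≗⇒≈ (λ k → trans (cong (c ℤ.*_) (⊛-distribˡ-Σₛ K (mono (+ 1) (suc i)) (eulerTerm (suc i)) k))
                        (*ₗ-distrib-Σₛ K c (λ m → mono (+ 1) (suc i) ⊛ eulerTerm (suc i) m) k)) ⟩
  Σₛ K (λ m → c *ₗ (mono (+ 1) (suc i) ⊛ eulerTerm (suc i) m))
    ≈⟨ ≗⇒≈ (Σₛ-cong-≗ K term≗) ⟩
  Σₛ K (doubleSumTerm i)
    ≈⟨ Σₛ-dropLast n (doubleSumTerm i) (mono-⊛-≈𝟘 (sgn i ℤ.* sgn K) (suc i + (suc i * K + tri K)) (qPochInv K) large) ⟩
  Σₛ n (doubleSumTerm i) ∎
  where
    open SetoidReasoning (≈-setoid (suc n))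
    K = suc n
    c = - sgn (suc i)
    term≗ : ∀ m → (c *ₗ (mono (+ 1) (suc i) ⊛ eulerTerm (suc i) m)) ≗ doubleSumTerm i m
    term≗ m k = trans (cong (c ℤ.*_) (mono-⊛-mono-⊛ (+ 1) (sgn m) (suc i) (suc i * m + tri m) (qPochInv m) k))
      (trans (*ₗ-mono-⊛ c (+ 1 ℤ.* sgn m) (suc i + (suc i * m + tri m)) (qPochInv m) k)
             (cong₂ (λ a b → (mono (a ℤ.* b) (suc i + (suc i * m + tri m)) ⊛ qPochInv m) k)
                    (ℤₚ.neg-involutive (sgn i)) (ℤₚ.*-identityˡ (sgn m))))
    large : K < suc i + (suc i * K + tri K)
    large = s≤s (ℕₚ.≤-trans (ℕₚ.≤-trans (ℕₚ.m≤m+n K (i * K)) (ℕₚ.m≤m+n _ (tri K))) (ℕₚ.m≤n+m _ i))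

smallestPartSum≈doubleSum : ∀ n → smallestPartSum 1 (suc n) ≈[ suc n ] Σₛ n (λ t → Σₛ n (doubleSumTerm t))
smallestPartSum≈doubleSum n = ≈-trans (≗⇒≈ (smallestPartSum-Σₛ 1 n)) (Σₛ-cong n (smallestPartTerm≈doubleSum n))

tri-half : ∀ k → (k * suc k) / 2 ≡ tri k
tri-half k = trans (cong (_/ 2) (double k)) (m*n/n≡m (tri k) 2)
  where
    double : ∀ k → k * suc k ≡ tri k * 2
    double zero    = refl
    double (suc k) = trans (solve 1 (λ k → (con 1 :+ k) :* (con 2 :+ k) := k :* (con 1 :+ k) :+ con 2 :* (con 1 :+ k)) refl k)
      (trans (cong (_+ 2 * suc k) (double k))
             (solve 2 (λ k r → r :* con 2 :+ con 2 :* (con 1 :+ k) := (con 1 :+ k :+ r) :* con 2) refl k (tri k)))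
      where open ℕ-Solver.+-*-Solver

geometric : ℕ → ℕ → Series
geometric c L = Σₛ L (λ t → mono (sgn t) (t * c))

geometric-⊛ : ∀ c L → ((𝟙 ⊕ mono (+ 1) c) ⊛ geometric c L) ≗ (𝟙 ⊕ mono (sgn L) (suc L * c))
geometric-⊛ c zero k = trans (⊛-comm (𝟙 ⊕ mono (+ 1) c) (mono (+ 1) 0) k)
  (trans (mono-0-⊛ (𝟙 ⊕ mono (+ 1) c) k) (cong (λ x → 𝟙 k ℤ.+ mono (+ 1) x k) (sym (ℕₚ.+-identityʳ c))))
geometric-⊛ c (suc L) k = begin
  (B ⊛ (geometric c L ⊕ M)) k
    ≡⟨ ⊛-distribˡ-⊕ B (geometric c L) M k ⟩
  (B ⊛ geometric c L) k ℤ.+ (B ⊛ M) k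
    ≡⟨ cong₂ ℤ._+_ (geometric-⊛ c L k) (𝟙⊕f-⊛ (mono (+ 1) c) M k) ⟩
  (𝟙 k ℤ.+ x) ℤ.+ (y ℤ.+ (mono (+ 1) c ⊛ M) k)
    ≡⟨ cong (λ u → (𝟙 k ℤ.+ x) ℤ.+ (y ℤ.+ u))
            (trans (mono-⊛-mono (+ 1) (sgn (suc L)) c (suc L * c) k)
                   (cong (λ d → mono d (suc (suc L) * c) k) (ℤₚ.*-identityˡ _))) ⟩
  (𝟙 k ℤ.+ x) ℤ.+ (y ℤ.+ z)
    ≡⟨ solve 4 (λ a x y z → (a :+ x) :+ (y :+ z) := a :+ (x :+ y) :+ z) refl (𝟙 k) x y z ⟩
  𝟙 k ℤ.+ (x ℤ.+ y) ℤ.+ z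
    ≡⟨ cong (λ u → 𝟙 k ℤ.+ u ℤ.+ z) (cancel (sgn L) (suc L * c)) ⟩
  𝟙 k ℤ.+ + 0 ℤ.+ z
    ≡⟨ cong (ℤ._+ z) (ℤₚ.+-identityʳ (𝟙 k)) ⟩
  𝟙 k ℤ.+ z ∎
  where
    open ≡-Reasoning
    open +-*-Solver
    B = 𝟙 ⊕ mono (+ 1) c
    M = mono (sgn (suc L)) (suc L * c)
    x = mono (sgn L) (suc L * c) k
    y = M k
    z = mono (sgn (suc L)) (suc (suc L) * c) k
    cancel : ∀ a e → mono a e k ℤ.+ mono (- a) e k ≡ + 0
    cancel a e with e ≡ᵇ k
    ... | true  = ℤₚ.+-inverseʳ a
    ... | false = refl

inv-𝟙⊕mono : ∀ K c → inv (𝟙 ⊕ mono (+ 1) (suc c)) ≈[ K ] geometric (suc c) K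
inv-𝟙⊕mono K c = ≈-sym (inv-unique (geometric (suc c) K) B refl (λ k k≤K →
  trans (⊛-comm (geometric (suc c) K) B k)
  (trans (geometric-⊛ (suc c) K k)
  (trans (cong (ℤ._+_ (𝟙 k)) (mono-< (sgn K) (ℕₚ.≤-trans (s≤s k≤K) (ℕₚ.m≤m*n (suc K) (suc c)))))
         (ℤₚ.+-identityʳ (𝟙 k))))))
  where B = 𝟙 ⊕ mono (+ 1) (suc c)

midTerm≈doubleSum : ∀ n m → midTerm (suc m) ≈[ suc n ] Σₛ n (λ t → doubleSumTerm t m)
midTerm≈doubleSum n m = begin
  midTerm (suc m)
    ≈⟨ ≗⇒≈ (λ k → cong (λ e → (mono (sgn m) e ⊛ inv (poch (+ 1) 1 m ⊛ B)) k) (tri-half (suc m))) ⟩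
  Mo ⊛ inv (poch (+ 1) 1 m ⊛ B)
    ≈⟨ ≗⇒≈ (⊛-congʳ-≗ Mo (inv-⊛ (poch (+ 1) 1 m) B (poch-constant (+ 1) 0 m) refl)) ⟩
  Mo ⊛ (qPochInv m ⊛ inv B)
    ≈⟨ ⊛-congʳ Mo (⊛-congʳ (qPochInv m) (inv-𝟙⊕mono K m)) ⟩
  Mo ⊛ (qPochInv m ⊛ geometric (suc m) K)
    ≈⟨ ≗⇒≈ (λ k → trans (sym (⊛-assoc Mo (qPochInv m) G k)) (⊛-comm (Mo ⊛ qPochInv m) G k)) ⟩
  geometric (suc m) K ⊛ (Mo ⊛ qPochInv m)
    ≈⟨ ≗⇒≈ (⊛-distribʳ-Σₛ K (λ t → mono (sgn t) (t * suc m)) (Mo ⊛ qPochInv m)) ⟩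
  Σₛ K (λ t → mono (sgn t) (t * suc m) ⊛ (Mo ⊛ qPochInv m))
    ≈⟨ ≗⇒≈ (Σₛ-cong-≗ K (λ t k → trans (mono-⊛-mono-⊛ (sgn t) (sgn m) (t * suc m) (tri (suc m)) (qPochInv m) k)
                                        (cong (λ e → (mono (sgn t ℤ.* sgn m) e ⊛ qPochInv m) k) (tri-shift t m)))) ⟩
  Σₛ K (λ t → doubleSumTerm t m)
    ≈⟨ Σₛ-dropLast n (λ t → doubleSumTerm t m)
         (mono-⊛-≈𝟘 (sgn K ℤ.* sgn m) (suc K + (suc K * m + tri m)) (qPochInv m)
                    (ℕₚ.≤-trans (ℕₚ.n<1+n K) (ℕₚ.m≤m+n (suc K) _))) ⟩
  Σₛ n (λ t → doubleSumTerm t m) ∎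
  where
    open SetoidReasoning (≈-setoid (suc n))
    K  = suc n
    B  = 𝟙 ⊕ mono (+ 1) (suc m)
    Mo = mono (sgn m) (tri (suc m))
    G  = geometric (suc m) K

midSeries≡smallestPartSum : ∀ n → midSeries (suc n) ≡ smallestPartSum 1 (suc n) (suc n)
midSeries≡smallestPartSum n = begin
  midSeries (suc n)                                  ≡⟨ sumFrom1-suc n (λ m → midTerm m (suc n)) ⟩
  Σₛ n (midTerm ∘ suc) (suc n)                       ≡⟨ Σₛ-cong n (λ m _ → midTerm≈doubleSum n m) (suc n) ℕₚ.≤-refl ⟩
  Σₛ n (λ m → Σₛ n (λ t → doubleSumTerm t m)) (suc n) ≡⟨ Σₛ-swap n n (λ m t → doubleSumTerm t m) (suc n) ⟩
  Σₛ n (λ t → Σₛ n (doubleSumTerm t)) (suc n)         ≡⟨ sym (smallestPartSum≈doubleSum n (suc n) ℕₚ.≤-refl) ⟩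
  smallestPartSum 1 (suc n) (suc n)                  ∎
  where open ≡-Reasoning

finiteRhs : ℕ → Series
finiteRhs N = poch (+ 1) 1 N ⊖ (poch (+ 1) 1 N ⊘ poch (- + 1) 1 N)

rhsSeries≈finiteRhs : ∀ N → rhsSeries ≈[ N ] finiteRhs N
rhsSeries≈finiteRhs N k k≤N = cong₂ ℤ._-_ (pochInf≈poch (+ 1) N k k≤N)
  (≈-trans (⊛-congˡ (inv (pochInf (- + 1) 1)) (pochInf≈poch (+ 1) N))
           (⊛-congʳ (poch (+ 1) 1 N) (inv-cong (pochInf (- + 1) 1) (poch (- + 1) 1 N)
                      (poch-constant (- + 1) 0 1) (poch-constant (- + 1) 0 N) (pochInf≈poch (- + 1) N))) k k≤N)

smallestPartSum≈finiteRhs : ∀ n → smallestPartSum 1 (suc n) ≈[ suc n ] finiteRhs (suc n)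
smallestPartSum≈finiteRhs n k k≤K = trans (smallestPartSum≡poch⊖tailSum n k)
  (cong (ℤ._-_ (poch (+ 1) 1 (suc n) k)) (tailSum-one n k k≤K))

corollary3p3 : (N : ℕ) → (lhsSeries N ≡ midSeries N) × (midSeries N ≡ rhsSeries N)
corollary3p3 zero    = refl , refl
corollary3p3 (suc n) =
  trans (dcount≡smallestPartSum n) (sym (midSeries≡smallestPartSum n)) ,
  trans (midSeries≡smallestPartSum n)
        (trans (smallestPartSum≈finiteRhs n (suc n) ℕₚ.≤-refl) (sym (rhsSeries≈finiteRhs (suc n) (suc n) ℕₚ.≤-refl)))
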